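{- Let $B$ be an integral base-polyhedron in $\mathbb{R}^S$ and for $z\in\mathbb{Z}^S$ let $\Delta(z):=\sum\{|z(s)-z(t)|: s,t\in S,\ s\neq t\}$. An element $m$ of $B\cap\mathbb{Z}^S$ minimizes $\Delta$ over $B\cap\mathbb{Z}^S$ if and only if $m$ is a decreasingly minimal element of $B\cap\mathbb{Z}^S$.
   Context: $S$ is a finite non-empty set; the sum in $\Delta$ is over ordered pairs $(s,t)$ of distinct elements. An integral base-polyhedron is $B=B'(p)=\{x\in\mathbb{R}^S:\widetilde x(S)=p(S),\ \widetilde x(Z)\ge p(Z)\ \forall Z\subset S\}$, $\widetilde x(Z)=\sum_{s\in Z}x(s)$, with $p$ a set-function with values in $\mathbb{Z}\cup\{ -\infty\}$, $p(\emptyset)=0$, $p(S)$ finite, supermodular ($p(X)+p(Y)\le p(X\cap Y)+p(X\cup Y)$ whenever finite). With $x{\downarrow}$ the decreasing rearrangement, $m$ is decreasingly minimal in $B\cap\mathbb{Z}^S$ if for every $y$ in it, $m{\downarrow}=y{\downarrow}$ or $m{\downarrow}(j)<y{\downarrow}(j)$ at the first differing index. -}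

module Defs where

open import Data.Nat using (ℕ; zero; suc)
import Data.Nat as ℕ
open import Data.Integer using (ℤ; _-_; ∣_∣; _<_; _≤_) renaming (_+_ to _+ℤ_)
import Data.Integer as ℤ
open import Data.Integer.Properties using (≤-decTotalOrder)
open import Data.Fin using (Fin; _≟_)
open import Data.Fin.Subset using (Subset; ⊥; ⊤; _∩_; _∪_)
open import Data.Vec using (lookup)
open import Data.Bool using (if_then_else_)
open import Data.Maybe using (Maybe; just; nothing)
open import Data.List using (List; []; _∷_; reverse; allFin; map)
open import Data.List.Sort ≤-decTotalOrder using (sort)
open import Data.Product using (Σ; _×_; _,_)
open import Data.Sum using (_⊎_)
open import Relation.Nullary using (yes; no)
open import Relation.Binary.PropositionalEquality using (_≡_)

-- Ground set S = Fin n.  Values of p: Maybe ℤ, with  nothing  standing for -∞.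

Σℤ : ∀ {n} → (Fin n → ℤ) → ℤ
Σℤ {zero}  f = ℤ.0ℤ
Σℤ {suc n} f = f Fin.zero +ℤ Σℤ (λ i → f (Fin.suc i))
  where import Data.Fin as Fin

Σℕ : ∀ {n} → (Fin n → ℕ) → ℕ
Σℕ {zero}  f = 0
Σℕ {suc n} f = f Fin.zero ℕ.+ Σℕ (λ i → f (Fin.suc i))
  where import Data.Fin as Fin

x̃ : ∀ {n} → (Fin n → ℤ) → Subset n → ℤ
x̃ x Z = Σℤ (λ s → if lookup Z s then x s else ℤ.0ℤ)

record Supermodular {n : ℕ} (p : Subset n → Maybe ℤ) : Set where
  field
    p-empty : p ⊥ ≡ just ℤ.0ℤ
    p-full  : Σ ℤ (λ v → p ⊤ ≡ just v)
    supermod : ∀ X Y a b → p X ≡ just a → p Y ≡ just b →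
      Σ ℤ (λ c → Σ ℤ (λ d → p (X ∩ Y) ≡ just c × p (X ∪ Y) ≡ just d × (a +ℤ b) ≤ (c +ℤ d)))

InB : ∀ {n} → (Subset n → Maybe ℤ) → (Fin n → ℤ) → Set
InB p x = (∀ v → p ⊤ ≡ just v → x̃ x ⊤ ≡ v)
        × (∀ Z v → p Z ≡ just v → v ≤ x̃ x Z)

pairTerm : ∀ {n} → (Fin n → ℤ) → (s t : Fin n) → ℕ
pairTerm z s t with s ≟ t
... | yes _ = 0
... | no _  = ∣ z s - z t ∣

Δ : ∀ {n} → (Fin n → ℤ) → ℕ
Δ z = Σℕ (λ s → Σℕ (λ t → pairTerm z s t))

_↓ : ∀ {n} → (Fin n → ℤ) → List ℤ
x ↓ = reverse (sort (map x (allFin _)))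

LexLeq : List ℤ → List ℤ → Set
LexLeq []       []       = Data.Unit.⊤ where import Data.Unit
LexLeq []       (_ ∷ _)  = Data.Empty.⊥ where import Data.Empty
LexLeq (_ ∷ _)  []       = Data.Empty.⊥ where import Data.Empty
LexLeq (a ∷ as) (b ∷ bs) = (a < b) ⊎ (a ≡ b × LexLeq as bs)

DecMin : ∀ {n} → (Subset n → Maybe ℤ) → (Fin n → ℤ) → Set
DecMin p m = InB p m × (∀ y → InB p y → LexLeq (m ↓) (y ↓))

MinimizesΔ : ∀ {n} → (Subset n → Maybe ℤ) → (Fin n → ℤ) → Set
MinimizesΔ p m = InB p m × (∀ y → InB p y → Δ m ℕ.≤ Δ y)

module Submission where

open import Defs
open import Data.Nat using (ℕ; zero; suc)
open import Data.Integer using (ℤ)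
open import Data.Fin using (Fin; zero; suc)
open import Data.Fin.Subset using (Subset)
open import Data.Maybe using (Maybe; just)
open import Function.Bundles using (_⇔_; mk⇔)

open import Data.Bool using (Bool; true; false; if_then_else_; _∧_; _∨_)
open import Data.Fin.Properties using (_≟_; all?; ¬∀⟶∃¬)
open import Data.Fin.Subset using (⊤; ⊥; _∩_; _∪_; _∈_; _∉_; ⋂; ⋃)
open import Data.Fin.Subset.Properties
  using (_∈?_; ∈⊤; ∉⊥; x∈p∩q⁺; x∈p∩q⁻; x∈p∪q⁺; x∈p∪q⁻; anySubset?)
open import Data.Integer using (+_; -[1+_]; 0ℤ; 1ℤ; _+_; _-_; -_; _⊔_; ∣_∣)
import Data.Integer as ℤ
import Data.Integer.Properties as ℤ
open import Data.Integer.Tactic.RingSolver using (solve-∀)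
open import Data.List using (List; []; _∷_; _++_; tabulate; map; foldr; reverse; allFin; length)
open import Data.List.Membership.Propositional using () renaming (_∈_ to _∈ˡ_)
open import Data.List.Membership.Propositional.Properties using (∈-∃++; ∈-allFin)
import Data.List.Properties as List
open import Data.List.Relation.Binary.Permutation.Propositional
  using (_↭_; ↭-sym; ↭-trans; ↭-reflexive; ↭-prep; ↭⇒↭ₛ)
import Data.List.Relation.Binary.Permutation.Propositional.Properties as ↭
open import Data.List.Relation.Binary.Permutation.Setoid.Properties using (foldr-commMonoid; Unique-resp-↭)
open import Data.List.Relation.Unary.All as All using (All; []; _∷_)
import Data.List.Relation.Unary.All.Properties as Allₚ
open import Data.List.Relation.Unary.AllPairs using (AllPairs; []; _∷_)
import Data.List.Relation.Unary.AllPairs.Properties as AllPairs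
open import Data.List.Relation.Unary.Any as Any using (Any; here; there)
import Data.List.Relation.Unary.Any.Properties as Anyₚ
import Data.List.Relation.Unary.Sorted.TotalOrder.Properties as Sorted
open import Data.List.Relation.Unary.Unique.Propositional using (Unique)
open import Data.List.Relation.Unary.Unique.Propositional.Properties using (allFin⁺)
open import Data.List.Sort ℤ.≤-decTotalOrder using (sort-↭; sort-↗)
import Data.Maybe.Properties as Maybe
import Data.Nat as ℕ
open import Data.Nat.Induction using (<-wellFounded)
open import Data.Nat.ListAction using (sum)
open import Data.Nat.ListAction.Properties using (sum-↭)
import Data.Nat.Properties as ℕ
import Data.Nat.Tactic.RingSolver as ℕ-Solver
open import Data.Product using (∃; ∃₂; _×_; _,_; proj₁; proj₂)
open import Data.Sum using (_⊎_; inj₁; inj₂)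
open import Data.Vec using ([]; _∷_; lookup)
open import Data.Vec.Properties using (lookup-zipWith; lookup-replicate; []=⇒lookup; lookup⇒[]=)
open import Function using (_∘_; id)
open import Induction.WellFounded using (Acc; acc)
open import Relation.Binary.Bundles using (DecTotalOrder)
open import Relation.Binary.Core using (_Preserves_⟶_)
open import Relation.Binary.Definitions using (tri<; tri≈; tri>)
open import Relation.Binary.PropositionalEquality
open import Relation.Nullary using (Dec; yes; no; does; ¬_; ¬?; contradiction)
open import Relation.Nullary.Decidable using (_×-dec_; _→-dec_)
open import Relation.Unary using (Decidable)
open import Algebra.Properties.CommutativeSemigroup ℕ.+-commutativeSemigroup
  using () renaming (interchange to ℕ+-interchange)
open import Algebra.Properties.CommutativeSemigroup ℤ.+-commutativeSemigroup
  using () renaming (interchange to ℤ+-interchange)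

-- Call x ∈ B balanced if, whenever x(t) ≥ x(s) + 2, some tight set contains t but not s. If no tight
-- set separates such t from s, moving one unit from t to s stays in B and strictly decreases Δ, so
-- Δ-minimisers are balanced. Tight sets are closed under ∩ and ∪ (modularity of x̃ against
-- supermodularity of p); hence for balanced x and every threshold c there is a tight set containing
-- {x > c} and avoiding {x < c}, and the inequality defining B on that set shows that x minimises
-- Σ (x(s) − c)⁺ over B for every c. These threshold sums determine the lexicographic order of
-- decreasing rearrangements, so balanced elements are decreasingly minimal. Conversely, Δ-decreasing
-- transfers lead from any y ∈ B to a balanced y*; it has the same decreasing rearrangement as the
-- decreasingly minimal m, and Δ only depends on that rearrangement, so Δ m = Δ y* ≤ Δ y.

private
  variable
    k : ℕ

+-cancelˡ-≤ : ∀ a b c → c + a ℤ.≤ c + b → a ℤ.≤ b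
+-cancelˡ-≤ a b c c+a≤c+b =
  subst₂ ℤ._≤_ (cancel c a) (cancel c b) (ℤ.+-monoʳ-≤ (- c) c+a≤c+b)
  where
  cancel : ∀ c a → - c + (c + a) ≡ a
  cancel = solve-∀

+-≤-squeeze : ∀ {a b c d} → c ℤ.≤ a → d ℤ.≤ b → a + b ℤ.≤ c + d → c ≡ a × d ≡ b
+-≤-squeeze {a} {b} {c} {d} c≤a d≤b a+b≤c+d =
  ℤ.≤-antisym c≤a (+-cancelˡ-≤ a c b (subst₂ ℤ._≤_ (ℤ.+-comm a b) (ℤ.+-comm c b)
                                         (ℤ.≤-trans a+b≤c+d (ℤ.+-monoʳ-≤ c d≤b)))) ,
  ℤ.≤-antisym d≤b (+-cancelˡ-≤ b d a (ℤ.≤-trans a+b≤c+d (ℤ.+-monoˡ-≤ d c≤a)))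

i<i+1 : ∀ i → i ℤ.< i + 1ℤ
i<i+1 i = ℤ.suc[i]≤j⇒i<j (ℤ.≤-reflexive (ℤ.+-comm 1ℤ i))

i<j⇒i-j<0 : ∀ {i j} → i ℤ.< j → i - j ℤ.< 0ℤ
i<j⇒i-j<0 {i} {j} i<j = subst (i - j ℤ.<_) (ℤ.+-inverseʳ j) (ℤ.+-monoˡ-< (- j) i<j)

∣i+1∣<∣i∣ : ∀ {i} → i ℤ.< 0ℤ → ∣ i + 1ℤ ∣ ℕ.< ∣ i ∣
∣i+1∣<∣i∣ { -[1+ zero ]}  _       = ℕ.n<1+n 0
∣i+1∣<∣i∣ { -[1+ suc n ]} _       = ℕ.n<1+n (suc n)
∣i+1∣<∣i∣ {+ n}           (ℤ.+<+ ())

∣i-1∣<∣i∣ : ∀ {i} → 0ℤ ℤ.< i → ∣ i - 1ℤ ∣ ℕ.< ∣ i ∣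
∣i-1∣<∣i∣ {+ suc n} _           = ℕ.n<1+n n
∣i-1∣<∣i∣ {+ zero}  (ℤ.+<+ ())

∣i±1∣≤1+∣i∣ : ∀ i j → ∣ j ∣ ≡ 1 → ∣ i + j ∣ ℕ.≤ suc ∣ i ∣
∣i±1∣≤1+∣i∣ i j ∣j∣≡1 = subst (∣ i + j ∣ ℕ.≤_) (trans (cong (∣ i ∣ ℕ.+_) ∣j∣≡1) (ℕ.+-comm ∣ i ∣ 1))
                                          (ℤ.∣i+j∣≤∣i∣+∣j∣ i j)

+-trade-≤ : ∀ {m n o p} → m ℕ.< n → o ℕ.≤ suc p → m ℕ.+ o ℕ.≤ n ℕ.+ p
+-trade-≤ {m} {n} {o} {p} m<n o≤1+p = begin
  m ℕ.+ o       ≤⟨ ℕ.+-monoʳ-≤ m o≤1+p ⟩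
  m ℕ.+ suc p   ≡⟨ ℕ.+-suc m p ⟩
  suc m ℕ.+ p   ≤⟨ ℕ.+-monoˡ-≤ p m<n ⟩
  n ℕ.+ p       ∎
  where open ℕ.≤-Reasoning

-- One of the two moves goes towards 0 (i < 0 or j > 0) and gains 1; the other loses at most 1.
∣i+1∣+∣j-1∣≤∣i∣+∣j∣ : ∀ {i j} → i + 1ℤ ℤ.< j → ∣ i + 1ℤ ∣ ℕ.+ ∣ j - 1ℤ ∣ ℕ.≤ ∣ i ∣ ℕ.+ ∣ j ∣
∣i+1∣+∣j-1∣≤∣i∣+∣j∣ {i} {j} i+1<j with i ℤ.<? 0ℤ
... | yes i<0 = +-trade-≤ (∣i+1∣<∣i∣ i<0) (∣i±1∣≤1+∣i∣ j (- 1ℤ) refl)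
... | no  i≮0 = subst₂ ℕ._≤_ (ℕ.+-comm ∣ j - 1ℤ ∣ ∣ i + 1ℤ ∣) (ℕ.+-comm ∣ j ∣ ∣ i ∣)
                  (+-trade-≤ (∣i-1∣<∣i∣ 0<j) (∣i±1∣≤1+∣i∣ i 1ℤ refl))
  where
  0<j : 0ℤ ℤ.< j
  0<j = ℤ.≤-<-trans (ℤ.≤-trans (ℤ.≮⇒≥ i≮0) (ℤ.i≤i+j i 1ℤ)) i+1<j

-- Finite sums and the functional x̃

Σℤ-cong : {f g : Fin k → ℤ} → (∀ i → f i ≡ g i) → Σℤ f ≡ Σℤ g
Σℤ-cong {zero}  f≗g = refl
Σℤ-cong {suc k} f≗g = cong₂ _+_ (f≗g zero) (Σℤ-cong (f≗g ∘ suc))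

Σℤ-mono-≤ : {f g : Fin k → ℤ} → (∀ i → f i ℤ.≤ g i) → Σℤ f ℤ.≤ Σℤ g
Σℤ-mono-≤ {zero}  f≤g = ℤ.≤-refl
Σℤ-mono-≤ {suc k} f≤g = ℤ.+-mono-≤ (f≤g zero) (Σℤ-mono-≤ (f≤g ∘ suc))

Σℤ-+ : (f g : Fin k → ℤ) → Σℤ (λ i → f i + g i) ≡ Σℤ f + Σℤ g
Σℤ-+ {zero}  f g = refl
Σℤ-+ {suc k} f g = trans (cong (_+_ (f zero + g zero)) (Σℤ-+ (f ∘ suc) (g ∘ suc)))
                         (ℤ+-interchange (f zero) (g zero) (Σℤ (f ∘ suc)) (Σℤ (g ∘ suc)))

Σℤ-- : (f g : Fin k → ℤ) → Σℤ (λ i → f i - g i) ≡ Σℤ f - Σℤ g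
Σℤ-- {zero}  f g = refl
Σℤ-- {suc k} f g = trans (cong (_+_ (f zero - g zero)) (Σℤ-- (f ∘ suc) (g ∘ suc)))
                         (interchange (f zero) (g zero) (Σℤ (f ∘ suc)) (Σℤ (g ∘ suc)))
  where
  interchange : ∀ a b c d → (a - b) + (c - d) ≡ (a + c) - (b + d)
  interchange = solve-∀

sumℤ : List ℤ → ℤ
sumℤ = foldr _+_ 0ℤ

sumℤ-↭ : sumℤ Preserves _↭_ ⟶ _≡_
sumℤ-↭ xs↭ys = foldr-commMonoid (ℤ.≡-setoid) ℤ.+-0-isCommutativeMonoid (↭⇒↭ₛ xs↭ys)

Σℤ-tabulate : (f : Fin k → ℤ) → Σℤ f ≡ sumℤ (tabulate f)
Σℤ-tabulate {zero}  f = refl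
Σℤ-tabulate {suc k} f = cong (_+_ (f zero)) (Σℤ-tabulate (f ∘ suc))

Σℕ-tabulate : (f : Fin k → ℕ) → Σℕ f ≡ sum (tabulate f)
Σℕ-tabulate {zero}  f = refl
Σℕ-tabulate {suc k} f = cong (f zero ℕ.+_) (Σℕ-tabulate (f ∘ suc))

-- x̃ x Z is definitionally Σℤ (x ⇂ Z).
_⇂_ : (Fin k → ℤ) → Subset k → Fin k → ℤ
(x ⇂ Z) s = if lookup Z s then x s else 0ℤ

x̃-+ : (x y : Fin k → ℤ) (Z : Subset k) → x̃ (λ s → x s + y s) Z ≡ x̃ x Z + x̃ y Z
x̃-+ x y Z = trans (Σℤ-cong (λ s → if-+ (lookup Z s))) (Σℤ-+ (x ⇂ Z) (y ⇂ Z))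
  where
  if-+ : ∀ {a b} b? → (if b? then a + b else 0ℤ) ≡ (if b? then a else 0ℤ) + (if b? then b else 0ℤ)
  if-+ true  = refl
  if-+ false = refl

x̃-- : (x y : Fin k → ℤ) (Z : Subset k) → x̃ (λ s → x s - y s) Z ≡ x̃ x Z - x̃ y Z
x̃-- x y Z = trans (Σℤ-cong (λ s → if-- (lookup Z s))) (Σℤ-- (x ⇂ Z) (y ⇂ Z))
  where
  if-- : ∀ {a b} b? → (if b? then a - b else 0ℤ) ≡ (if b? then a else 0ℤ) - (if b? then b else 0ℤ)
  if-- true  = refl
  if-- false = refl

x̃-modular : (x : Fin k → ℤ) (X Y : Subset k) → x̃ x X + x̃ x Y ≡ x̃ x (X ∩ Y) + x̃ x (X ∪ Y)
x̃-modular x X Y = begin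
  x̃ x X + x̃ x Y                              ≡⟨ Σℤ-+ (x ⇂ X) (x ⇂ Y) ⟨
  Σℤ (λ s → (x ⇂ X) s + (x ⇂ Y) s)             ≡⟨ Σℤ-cong split ⟩
  Σℤ (λ s → (x ⇂ (X ∩ Y)) s + (x ⇂ (X ∪ Y)) s) ≡⟨ Σℤ-+ (x ⇂ (X ∩ Y)) (x ⇂ (X ∪ Y)) ⟩
  x̃ x (X ∩ Y) + x̃ x (X ∪ Y)                  ∎
  where
  open ≡-Reasoning
  if-∧∨ : ∀ a b c → (if b then a else 0ℤ) + (if c then a else 0ℤ)
                     ≡ (if b ∧ c then a else 0ℤ) + (if b ∨ c then a else 0ℤ)
  if-∧∨ a true  true  = refl
  if-∧∨ a true  false = ℤ.+-comm a 0ℤ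
  if-∧∨ a false c     = refl
  split : ∀ s → (x ⇂ X) s + (x ⇂ Y) s ≡ (x ⇂ (X ∩ Y)) s + (x ⇂ (X ∪ Y)) s
  split s rewrite lookup-zipWith _∧_ s X Y | lookup-zipWith _∨_ s X Y = if-∧∨ (x s) (lookup X s) (lookup Y s)

x̃-⊥ : (x : Fin k → ℤ) → x̃ x ⊥ ≡ 0ℤ
x̃-⊥ {zero}  x = refl
x̃-⊥ {suc k} x = trans (ℤ.+-identityˡ _) (x̃-⊥ (x ∘ suc))

lookup-∉ : ∀ {s : Fin k} {Z} → s ∉ Z → lookup Z s ≡ false
lookup-∉ {s = s} {Z} s∉Z with lookup Z s in eq
... | true  = contradiction (lookup⇒[]= s Z eq) s∉Z
... | false = refl

⟦_⟧ : Bool → ℤ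
⟦ b ⟧ = if b then 1ℤ else 0ℤ

χ : Fin k → Fin k → ℤ
χ s u = ⟦ does (s ≟ u) ⟧

x̃-χ : ∀ (s : Fin k) Z → x̃ (χ s) Z ≡ ⟦ lookup Z s ⟧
x̃-χ zero    (b ∷ Z) = trans (cong (_+_ ⟦ b ⟧) (x̃-0 Z)) (ℤ.+-identityʳ _)
  where
  x̃-0 : ∀ {k} (Z : Subset k) → x̃ (λ _ → 0ℤ) Z ≡ 0ℤ
  x̃-0 []            = refl
  x̃-0 (true  ∷ Z) = trans (ℤ.+-identityˡ _) (x̃-0 Z)
  x̃-0 (false ∷ Z) = trans (ℤ.+-identityˡ _) (x̃-0 Z)
x̃-χ (suc s) (true  ∷ Z) = trans (ℤ.+-identityˡ _) (x̃-χ s Z)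
x̃-χ (suc s) (false ∷ Z) = trans (ℤ.+-identityˡ _) (x̃-χ s Z)

∈-⋂ : ∀ {u : Fin k} {Zs} → All (u ∈_) Zs → u ∈ ⋂ Zs
∈-⋂ []           = ∈⊤
∈-⋂ (u∈Z ∷ u∈Zs) = x∈p∩q⁺ (u∈Z , ∈-⋂ u∈Zs)

∉-⋂ : ∀ {u : Fin k} {Zs} → Any (u ∉_) Zs → u ∉ ⋂ Zs
∉-⋂ {Zs = Z ∷ Zs} (here u∉Z)   u∈⋂ = u∉Z (proj₁ (x∈p∩q⁻ Z (⋂ Zs) u∈⋂))
∉-⋂ {Zs = Z ∷ Zs} (there u∉Zs) u∈⋂ = ∉-⋂ u∉Zs (proj₂ (x∈p∩q⁻ Z (⋂ Zs) u∈⋂))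

∈-⋃ : ∀ {u : Fin k} {Zs} → Any (u ∈_) Zs → u ∈ ⋃ Zs
∈-⋃ (here u∈Z)   = x∈p∪q⁺ (inj₁ u∈Z)
∈-⋃ (there u∈Zs) = x∈p∪q⁺ (inj₂ (∈-⋃ u∈Zs))

∉-⋃ : ∀ {u : Fin k} {Zs} → All (u ∉_) Zs → u ∉ ⋃ Zs
∉-⋃ {Zs = []}     []             = ∉⊥
∉-⋃ {Zs = Z ∷ Zs} (u∉Z ∷ u∉Zs) u∈⋃ with x∈p∪q⁻ Z (⋃ Zs) u∈⋃
... | inj₁ u∈Z  = u∉Z u∈Z
... | inj₂ u∈⋃Zs = ∉-⋃ u∉Zs u∈⋃Zs

-- Tight sets and unit transfers

Tight : (Subset k → Maybe ℤ) → (Fin k → ℤ) → Subset k → Set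
Tight p x Z = p Z ≡ just (x̃ x Z)

Separated : (Subset k → Maybe ℤ) → (Fin k → ℤ) → Fin k → Fin k → Set
Separated p x t s = ∃ λ Z → Tight p x Z × t ∈ Z × s ∉ Z

BalancedAt : (Subset k → Maybe ℤ) → (Fin k → ℤ) → Fin k → Fin k → Set
BalancedAt p x s t = x s + 1ℤ ℤ.< x t → Separated p x t s

Balanced : (Subset k → Maybe ℤ) → (Fin k → ℤ) → Set
Balanced p x = ∀ s t → BalancedAt p x s t

separated? : ∀ (p : Subset k → Maybe ℤ) x t s → Dec (Separated p x t s)
separated? p x t s = anySubset? λ Z →
  Maybe.≡-dec ℤ._≟_ (p Z) (just (x̃ x Z)) ×-dec t ∈? Z ×-dec ¬? (s ∈? Z)

balancedAt? : ∀ (p : Subset k → Maybe ℤ) x s t → Dec (BalancedAt p x s t)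
balancedAt? p x s t = (x s + 1ℤ ℤ.<? x t) →-dec separated? p x t s

balanced-or-improvable : ∀ (p : Subset k → Maybe ℤ) y →
  Balanced p y ⊎ ∃₂ λ s t → y s + 1ℤ ℤ.< y t × ¬ Separated p y t s
balanced-or-improvable {k} p y with all? (λ s → all? (balancedAt? p y s))
... | yes balanced = inj₁ balanced
... | no ¬balanced
  with s , ¬∀t ← ¬∀⟶∃¬ k _ (λ s → all? (balancedAt? p y s)) ¬balanced
  with t , ¬balancedAt ← ¬∀⟶∃¬ k _ (balancedAt? p y s) ¬∀t
  with y s + 1ℤ ℤ.<? y t
... | yes gap = inj₂ (s , t , gap , λ sep → ¬balancedAt λ _ → sep)
... | no ¬gap = contradiction (λ gap → contradiction gap ¬gap) ¬balancedAt

transfer : (Fin k → ℤ) → (to from : Fin k) → Fin k → ℤ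
transfer y s t u = (y u + χ s u) - χ t u

x̃-transfer : ∀ y (s t : Fin k) Z →
  x̃ (transfer y s t) Z ≡ (x̃ y Z + ⟦ lookup Z s ⟧) - ⟦ lookup Z t ⟧
x̃-transfer y s t Z = begin
  x̃ (transfer y s t) Z                      ≡⟨ x̃-- (λ u → y u + χ s u) (χ t) Z ⟩
  x̃ (λ u → y u + χ s u) Z - x̃ (χ t) Z       ≡⟨ cong₂ _-_ (x̃-+ y (χ s) Z) (x̃-χ t Z) ⟩
  (x̃ y Z + x̃ (χ s) Z) - ⟦ lookup Z t ⟧      ≡⟨ cong (λ a → (x̃ y Z + a) - ⟦ lookup Z t ⟧) (x̃-χ s Z) ⟩
  (x̃ y Z + ⟦ lookup Z s ⟧) - ⟦ lookup Z t ⟧  ∎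
  where open ≡-Reasoning

transfer-∈B : ∀ {p : Subset k → Maybe ℤ} {y s t} → InB p y → ¬ Separated p y t s → InB p (transfer y s t)
transfer-∈B {p = p} {y} {s} {t} (y∈B-⊤ , y∈B) unseparated = ∈B-⊤ , ∈B
  where
  +1-1 : ∀ a → (a + 1ℤ) - 1ℤ ≡ a
  +1-1 = solve-∀
  +0-0 : ∀ a → (a + 0ℤ) - 0ℤ ≡ a
  +0-0 = solve-∀
  +1-0 : ∀ a → (a + 1ℤ) - 0ℤ ≡ 1ℤ + a
  +1-0 = solve-∀
  +0-1 : ∀ a → (a + 0ℤ) - 1ℤ ≡ - 1ℤ + a
  +0-1 = solve-∀
  ∈B-⊤ : ∀ v → p ⊤ ≡ just v → x̃ (transfer y s t) ⊤ ≡ v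
  ∈B-⊤ v pv rewrite x̃-transfer y s t ⊤ | lookup-replicate s true | lookup-replicate t true =
    trans (+1-1 _) (y∈B-⊤ v pv)
  ∈B : ∀ Z v → p Z ≡ just v → v ℤ.≤ x̃ (transfer y s t) Z
  ∈B Z v pv rewrite x̃-transfer y s t Z with lookup Z s in s∈? | lookup Z t in t∈?
  ... | true  | true  = subst (v ℤ.≤_) (sym (+1-1 (x̃ y Z))) (y∈B Z v pv)
  ... | false | false = subst (v ℤ.≤_) (sym (+0-0 (x̃ y Z))) (y∈B Z v pv)
  ... | true  | false = subst (v ℤ.≤_) (sym (+1-0 (x̃ y Z))) (ℤ.≤-trans (y∈B Z v pv) (ℤ.i≤j+i (x̃ y Z) 1ℤ))
  ... | false | true  = subst (v ℤ.≤_) (sym (+0-1 (x̃ y Z))) (ℤ.i<j⇒i≤pred[j] v<x̃)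
    where
    v<x̃ : v ℤ.< x̃ y Z
    v<x̃ = ℤ.≤∧≢⇒< (y∈B Z v pv) λ v≡ →
      unseparated (Z , trans pv (cong just v≡) , lookup⇒[]= t Z t∈? ,
                   λ s∈Z → contradiction (trans (sym ([]=⇒lookup s∈Z)) s∈?) λ ())

transfer-to : ∀ (y : Fin k → ℤ) {s t} → t ≢ s → transfer y s t s ≡ y s + 1ℤ
transfer-to y {s} {t} t≢s with s ≟ s | t ≟ s
... | yes _   | no _    = ℤ.+-identityʳ _
... | no s≢s  | _       = contradiction refl s≢s
... | _       | yes t≡s = contradiction t≡s t≢s

transfer-from : ∀ (y : Fin k → ℤ) {s t} → s ≢ t → transfer y s t t ≡ y t - 1ℤ
transfer-from y {s} {t} s≢t with s ≟ t | t ≟ t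
... | no _    | yes _   = cong (_- 1ℤ) (ℤ.+-identityʳ (y t))
... | _       | no t≢t  = contradiction refl t≢t
... | yes s≡t | _       = contradiction s≡t s≢t

transfer-other : ∀ (y : Fin k → ℤ) {s t u} → s ≢ u → t ≢ u → transfer y s t u ≡ y u
transfer-other y {s} {t} {u} s≢u t≢u with s ≟ u | t ≟ u
... | no _    | no _    = trans (ℤ.+-identityʳ _) (ℤ.+-identityʳ _)
... | yes s≡u | _       = contradiction s≡u s≢u
... | _       | yes t≡u = contradiction t≡u t≢u

gap⇒≢ : ∀ (y : Fin k → ℤ) {s t} → y s + 1ℤ ℤ.< y t → s ≢ t
gap⇒≢ y gap refl = ℤ.<-asym gap (i<i+1 _)

_⁺ : ℤ → ℤ
i ⁺ = i ⊔ 0ℤ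

module TightSets (p : Subset k → Maybe ℤ) (p-super : Supermodular p) where
  open Supermodular p-super

  tight-⊤ : ∀ {x} → InB p x → Tight p x ⊤
  tight-⊤ (x∈B-⊤ , _) = trans (proj₂ p-full) (cong just (sym (x∈B-⊤ _ (proj₂ p-full))))

  tight-⊥ : ∀ x → Tight p x ⊥
  tight-⊥ x = trans p-empty (cong just (sym (x̃-⊥ x)))

  tight-∩∪ : ∀ {x X Y} → InB p x → Tight p x X → Tight p x Y → Tight p x (X ∩ Y) × Tight p x (X ∪ Y)
  tight-∩∪ {x} {X} {Y} (_ , x∈B) tX tY
    with c , d , pX∩Y , pX∪Y , sum≤ ← supermod X Y (x̃ x X) (x̃ x Y) tX tY
    with c≡ , d≡ ← +-≤-squeeze (x∈B _ c pX∩Y) (x∈B _ d pX∪Y)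
                               (subst (ℤ._≤ c + d) (x̃-modular x X Y) sum≤)
    = trans pX∩Y (cong just c≡) , trans pX∪Y (cong just d≡)

  tight-⋂ : ∀ {x Zs} → InB p x → All (Tight p x) Zs → Tight p x (⋂ Zs)
  tight-⋂ x∈B []         = tight-⊤ x∈B
  tight-⋂ x∈B (tZ ∷ tZs) = proj₁ (tight-∩∪ x∈B tZ (tight-⋂ x∈B tZs))

  tight-⋃ : ∀ {x Zs} → InB p x → All (Tight p x) Zs → Tight p x (⋃ Zs)
  tight-⋃ {x} x∈B []         = tight-⊥ x
  tight-⋃     x∈B (tZ ∷ tZs) = proj₂ (tight-∩∪ x∈B tZ (tight-⋃ x∈B tZs))

  tight-avoiding : ∀ {x t} {P : Fin k → Set} → Decidable P → InB p x →
    (∀ s → P s → Separated p x t s) →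
    ∃ λ Z → Tight p x Z × t ∈ Z × (∀ s → P s → s ∉ Z)
  tight-avoiding {x} {t} {P} P? x∈B separate =
    ⋂ Zs , tight-⋂ x∈B (Allₚ.tabulate⁺ (proj₁ ∘ proj₂ ∘ pick)) ,
    ∈-⋂ (Allₚ.tabulate⁺ (proj₁ ∘ proj₂ ∘ proj₂ ∘ pick)) ,
    λ s Ps → ∉-⋂ (Anyₚ.tabulate⁺ s (proj₂ (proj₂ (proj₂ (pick s))) Ps))
    where
    pick : ∀ s → ∃ λ Z → Tight p x Z × t ∈ Z × (P s → s ∉ Z)
    pick s with P? s
    ... | yes Ps = let Z , tZ , t∈Z , s∉Z = separate s Ps in Z , tZ , t∈Z , λ _ → s∉Z
    ... | no ¬Ps = ⊤ , tight-⊤ x∈B , ∈⊤ , λ Ps → contradiction Ps ¬Ps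
    Zs = tabulate (proj₁ ∘ pick)

  tight-covering : ∀ {x} {P Q : Fin k → Set} → Decidable Q → InB p x →
    (∀ t → Q t → ∃ λ Z → Tight p x Z × t ∈ Z × (∀ s → P s → s ∉ Z)) →
    ∃ λ Z → Tight p x Z × (∀ t → Q t → t ∈ Z) × (∀ s → P s → s ∉ Z)
  tight-covering {x} {P} {Q} Q? x∈B cover =
    ⋃ Zs , tight-⋃ x∈B (Allₚ.tabulate⁺ (proj₁ ∘ proj₂ ∘ pick)) ,
    (λ t Qt → ∈-⋃ (Anyₚ.tabulate⁺ t (proj₁ (proj₂ (proj₂ (pick t))) Qt))) ,
    λ s Ps → ∉-⋃ (Allₚ.tabulate⁺ (λ t → proj₂ (proj₂ (proj₂ (pick t))) s Ps))
    where
    pick : ∀ t → ∃ λ Z → Tight p x Z × (Q t → t ∈ Z) × (∀ s → P s → s ∉ Z)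
    pick t with Q? t
    ... | yes Qt = let Z , tZ , t∈Z , P∉Z = cover t Qt in Z , tZ , (λ _ → t∈Z) , P∉Z
    ... | no ¬Qt = ⊥ , tight-⊥ x , (λ Qt → contradiction Qt ¬Qt) , λ _ _ → ∉⊥
    Zs = tabulate (proj₁ ∘ pick)

  level-set : ∀ {x} → InB p x → Balanced p x → ∀ c →
    ∃ λ Z → Tight p x Z × (∀ t → c ℤ.< x t → t ∈ Z) × (∀ s → x s ℤ.< c → s ∉ Z)
  level-set {x} x∈B balanced c =
    tight-covering (λ t → c ℤ.<? x t) x∈B λ t c<xt →
      tight-avoiding (λ s → x s ℤ.<? c) x∈B λ s xs<c →
        balanced s t (ℤ.≤-<-trans (subst (ℤ._≤ c) (ℤ.+-comm 1ℤ (x s)) (ℤ.i<j⇒suc[i]≤j xs<c)) c<xt)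

  excess-minimal : ∀ {x z} → InB p x → Balanced p x → InB p z → ∀ c →
    Σℤ (λ s → (x s - c) ⁺) ℤ.≤ Σℤ (λ s → (z s - c) ⁺)
  excess-minimal {x} {z} x∈B balanced (_ , z∈B) c
    with Z , tZ , above⊆Z , below∩Z≡∅ ← level-set x∈B balanced c = begin
    Σℤ (λ s → (x s - c) ⁺)          ≡⟨ Σℤ-cong ⁺≡restrict ⟩
    Σℤ ((λ s → x s - c) ⇂ Z)        ≡⟨ x̃-- x (λ _ → c) Z ⟩
    x̃ x Z - x̃ (λ _ → c) Z           ≤⟨ ℤ.+-monoˡ-≤ (- x̃ (λ _ → c) Z) (z∈B Z (x̃ x Z) tZ) ⟩
    x̃ z Z - x̃ (λ _ → c) Z           ≡⟨ x̃-- z (λ _ → c) Z ⟨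
    Σℤ ((λ s → z s - c) ⇂ Z)        ≤⟨ Σℤ-mono-≤ restrict≤⁺ ⟩
    Σℤ (λ s → (z s - c) ⁺)          ∎
    where
    open ℤ.≤-Reasoning
    ⁺≡restrict : ∀ s → (x s - c) ⁺ ≡ ((λ s → x s - c) ⇂ Z) s
    ⁺≡restrict s with s ∈? Z
    ... | yes s∈Z rewrite []=⇒lookup s∈Z =
      ℤ.i≥j⇒i⊔j≡i (ℤ.i≤j⇒0≤j-i (ℤ.≮⇒≥ λ xs<c → below∩Z≡∅ s xs<c s∈Z))
    ... | no  s∉Z rewrite lookup-∉ s∉Z =
      ℤ.i≤j⇒i⊔j≡j (ℤ.i≤j⇒i-j≤0 (ℤ.≮⇒≥ λ c<xs → s∉Z (above⊆Z s c<xs)))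
    restrict≤⁺ : ∀ s → ((λ s → z s - c) ⇂ Z) s ℤ.≤ (z s - c) ⁺
    restrict≤⁺ s with lookup Z s
    ... | true  = ℤ.i≤i⊔j (z s - c) 0ℤ
    ... | false = ℤ.i≤j⊔i (z s - c) 0ℤ

-- Decreasing rearrangements

↓-↭ : (x : Fin k → ℤ) → x ↓ ↭ tabulate x
↓-↭ x = ↭-trans (↭.↭-reverse _) (↭-trans (sort-↭ _) (↭-reflexive (List.map-tabulate id x)))

Descending : List ℤ → Set
Descending = AllPairs (λ a b → b ℤ.≤ a)

reverse-ascending : ∀ {xs} → AllPairs ℤ._≤_ xs → Descending (reverse xs)
reverse-ascending {[]}     []          = []
reverse-ascending {x ∷ xs} (x≤xs ∷ xs↗) rewrite List.unfold-reverse x xs =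
  AllPairs.++⁺ (reverse-ascending xs↗) ([] ∷ [])
    (All.map (_∷ []) (↭.All-resp-↭ (↭-sym (↭.↭-reverse xs)) x≤xs))

↓-descending : (x : Fin k → ℤ) → Descending (x ↓)
↓-descending x = reverse-ascending
  (Sorted.Sorted⇒AllPairs (DecTotalOrder.totalOrder ℤ.≤-decTotalOrder) (sort-↗ _))

excess : ℤ → List ℤ → ℤ
excess c L = sumℤ (map (λ v → (v - c) ⁺) L)

excess-↓ : (x : Fin k → ℤ) (c : ℤ) → Σℤ (λ s → (x s - c) ⁺) ≡ excess c (x ↓)
excess-↓ x c = begin
  Σℤ (λ s → (x s - c) ⁺)                   ≡⟨ Σℤ-tabulate (λ s → (x s - c) ⁺) ⟩
  sumℤ (tabulate (λ s → (x s - c) ⁺))      ≡⟨ cong sumℤ (List.map-tabulate x (λ v → (v - c) ⁺)) ⟨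
  sumℤ (map (λ v → (v - c) ⁺) (tabulate x)) ≡⟨ sumℤ-↭ (↭.map⁺ _ (↭-sym (↓-↭ x))) ⟩
  excess c (x ↓)                           ∎
  where open ≡-Reasoning

excess-nonneg : ∀ c L → 0ℤ ℤ.≤ excess c L
excess-nonneg c []      = ℤ.≤-refl
excess-nonneg c (v ∷ L) = ℤ.+-mono-≤ (ℤ.i≤j⊔i (v - c) 0ℤ) (excess-nonneg c L)

excess-≡0 : ∀ {c L} → All (ℤ._≤ c) L → excess c L ≡ 0ℤ
excess-≡0 {c} []         = refl
excess-≡0 {c} (v≤c ∷ L≤c) = cong₂ _+_ (ℤ.i≤j⇒i⊔j≡j (ℤ.i≤j⇒i-j≤0 v≤c)) (excess-≡0 L≤c)

lex-from-excess : ∀ {A B} → Descending A → Descending B → length A ≡ length B →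
  (∀ c → excess c A ℤ.≤ excess c B) → LexLeq A B
lex-from-excess {[]}    {[]}    _ _ _ _ = _
lex-from-excess {a ∷ A} {b ∷ B} (_ ∷ A↘) (B≤b ∷ B↘) |A|≡|B| excessA≤B with ℤ.<-cmp a b
... | tri< a<b _ _ = inj₁ a<b
... | tri≈ _ refl _ = inj₂ (refl , lex-from-excess A↘ B↘ (ℕ.suc-injective |A|≡|B|)
                                     λ c → +-cancelˡ-≤ _ _ ((a - c) ⁺) (excessA≤B c))
... | tri> _ _ b<a = contradiction (ℤ.i-j≤0⇒i≤j a-b≤0) (ℤ.<⇒≱ b<a)
  where
  open ℤ.≤-Reasoning
  a-b≤0 : a - b ℤ.≤ 0ℤ
  a-b≤0 = begin
    a - b                   ≤⟨ ℤ.i≤i⊔j (a - b) 0ℤ ⟩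
    (a - b) ⁺               ≡⟨ ℤ.+-identityʳ _ ⟨
    (a - b) ⁺ + 0ℤ          ≤⟨ ℤ.+-monoʳ-≤ ((a - b) ⁺) (excess-nonneg b A) ⟩
    excess b (a ∷ A)        ≤⟨ excessA≤B b ⟩
    (b - b) ⁺ + excess b B  ≡⟨ cong₂ _+_ (cong _⁺ (ℤ.+-inverseʳ b)) (excess-≡0 B≤b) ⟩
    0ℤ                      ∎

lex-antisym : ∀ {A B} → LexLeq A B → LexLeq B A → A ≡ B
lex-antisym {[]}    {[]}    _ _ = refl
lex-antisym {a ∷ A} {b ∷ B} (inj₁ a<b)       (inj₁ b<a)          = contradiction b<a (ℤ.<-asym a<b)
lex-antisym {a ∷ A} {b ∷ B} (inj₁ a<b)       (inj₂ (refl , _))   = contradiction a<b (ℤ.<-irrefl refl)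
lex-antisym {a ∷ A} {b ∷ B} (inj₂ (refl , _)) (inj₁ b<a)         = contradiction b<a (ℤ.<-irrefl refl)
lex-antisym {a ∷ A} {b ∷ B} (inj₂ (refl , A≤B)) (inj₂ (_ , B≤A)) = cong (a ∷_) (lex-antisym A≤B B≤A)

-- The functional Δ

dist : ℤ → ℤ → ℕ
dist a b = ∣ a - b ∣

dist-self : ∀ a → dist a a ≡ 0
dist-self a = cong ∣_∣ (ℤ.+-inverseʳ a)

dist-comm : ∀ a b → dist a b ≡ dist b a
dist-comm = ℤ.∣i-j∣≡∣j-i∣

dist-approach : ∀ {a b} → a + 1ℤ ℤ.< b → ∀ c →
  dist (a + 1ℤ) c ℕ.+ dist (b - 1ℤ) c ℕ.≤ dist a c ℕ.+ dist b c
dist-approach {a} {b} a+1<b c =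
  subst₂ (λ u v → ∣ u ∣ ℕ.+ ∣ v ∣ ℕ.≤ dist a c ℕ.+ dist b c) (sym (shift a c 1ℤ)) (sym (shift b c (- 1ℤ)))
    (∣i+1∣+∣j-1∣≤∣i∣+∣j∣ {a - c} (subst (ℤ._< b - c) (shift a c 1ℤ) (ℤ.+-monoˡ-< (- c) a+1<b)))
  where
  shift : ∀ a c d → (a + d) - c ≡ (a - c) + d
  shift = solve-∀

dist-approach-self : ∀ {a b} → a + 1ℤ ℤ.< b → dist (a + 1ℤ) (b - 1ℤ) ℕ.< dist a b
dist-approach-self {a} {b} a+1<b = begin-strict
  dist (a + 1ℤ) (b - 1ℤ)    ≡⟨ cong ∣_∣ (shift a b) ⟩
  ∣ (a - b + 1ℤ) + 1ℤ ∣     <⟨ ∣i+1∣<∣i∣ a-b+1<0 ⟩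
  ∣ a - b + 1ℤ ∣            <⟨ ∣i+1∣<∣i∣ (ℤ.<-trans (i<i+1 (a - b)) a-b+1<0) ⟩
  dist a b                  ∎
  where
  open ℕ.≤-Reasoning
  shift : ∀ a b → (a + 1ℤ) - (b - 1ℤ) ≡ (a - b + 1ℤ) + 1ℤ
  shift = solve-∀
  a-b+1<0 : a - b + 1ℤ ℤ.< 0ℤ
  a-b+1<0 = subst (ℤ._< 0ℤ) (shift′ a b) (i<j⇒i-j<0 a+1<b)
    where
    shift′ : ∀ a b → (a + 1ℤ) - b ≡ a - b + 1ℤ
    shift′ = solve-∀

row : ℤ → List ℤ → ℕ
row a L = sum (map (dist a) L)

Δˡ : List ℤ → ℕ
Δˡ L = sum (map (λ a → row a L) L)

sum-map-mono-≤ : ∀ {A : Set} {f g : A → ℕ} → (∀ x → f x ℕ.≤ g x) → ∀ xs → sum (map f xs) ℕ.≤ sum (map g xs)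
sum-map-mono-≤ f≤g []       = ℕ.z≤n
sum-map-mono-≤ f≤g (x ∷ xs) = ℕ.+-mono-≤ (f≤g x) (sum-map-mono-≤ f≤g xs)

rows-approach : ∀ {a b} → a + 1ℤ ℤ.< b → ∀ R →
  row (a + 1ℤ) R ℕ.+ row (b - 1ℤ) R ℕ.≤ row a R ℕ.+ row b R
rows-approach         a+1<b []      = ℕ.z≤n
rows-approach {a} {b} a+1<b (c ∷ R) =
  subst₂ ℕ._≤_ (ℕ+-interchange (dist (a + 1ℤ) c) (dist (b - 1ℤ) c) (row (a + 1ℤ) R) (row (b - 1ℤ) R))
               (ℕ+-interchange (dist a c) (dist b c) (row a R) (row b R))
    (ℕ.+-mono-≤ (dist-approach {a} {b} a+1<b c) (rows-approach {a} {b} a+1<b R))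

Δˡ-split : ∀ a b R → Δˡ (a ∷ b ∷ R) ≡
  (dist a b ℕ.+ dist b a) ℕ.+ ((row a R ℕ.+ row b R) ℕ.+ sum (map (λ c → (dist c a ℕ.+ dist c b) ℕ.+ row c R) R))
Δˡ-split a b R = begin
  Δˡ (a ∷ b ∷ R)
    ≡⟨ cong₂ (λ x y → (x ℕ.+ (dist a b ℕ.+ row a R)) ℕ.+ ((dist b a ℕ.+ (y ℕ.+ row b R)) ℕ.+ cols))
             (dist-self a) (dist-self b) ⟩
  (dist a b ℕ.+ row a R) ℕ.+ ((dist b a ℕ.+ row b R) ℕ.+ cols)
    ≡⟨ cong (λ S → (dist a b ℕ.+ row a R) ℕ.+ ((dist b a ℕ.+ row b R) ℕ.+ S))
            (cong sum (List.map-cong (λ c → sym (ℕ.+-assoc (dist c a) (dist c b) (row c R))) R)) ⟩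
  (dist a b ℕ.+ row a R) ℕ.+ ((dist b a ℕ.+ row b R) ℕ.+ cols′)
    ≡⟨ arrange (dist a b) (dist b a) (row a R) (row b R) cols′ ⟩
  (dist a b ℕ.+ dist b a) ℕ.+ ((row a R ℕ.+ row b R) ℕ.+ cols′)  ∎
  where
  open ≡-Reasoning
  cols = sum (map (λ c → dist c a ℕ.+ (dist c b ℕ.+ row c R)) R)
  cols′ = sum (map (λ c → (dist c a ℕ.+ dist c b) ℕ.+ row c R) R)
  arrange : ∀ p q r s S → (p ℕ.+ r) ℕ.+ ((q ℕ.+ s) ℕ.+ S) ≡ (p ℕ.+ q) ℕ.+ ((r ℕ.+ s) ℕ.+ S)
  arrange = ℕ-Solver.solve-∀

Δˡ-approach : ∀ {a b} → a + 1ℤ ℤ.< b → ∀ R → Δˡ ((a + 1ℤ) ∷ (b - 1ℤ) ∷ R) ℕ.< Δˡ (a ∷ b ∷ R)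
Δˡ-approach {a} {b} a+1<b R = subst₂ ℕ._<_ (sym (Δˡ-split (a + 1ℤ) (b - 1ℤ) R)) (sym (Δˡ-split a b R))
  (ℕ.+-mono-<-≤ (ℕ.+-mono-< (dist-approach-self {a} {b} a+1<b)
                             (subst₂ ℕ._<_ (dist-comm (a + 1ℤ) (b - 1ℤ)) (dist-comm a b) (dist-approach-self {a} {b} a+1<b)))
                (ℕ.+-mono-≤ (rows-approach {a} {b} a+1<b R)
                             (sum-map-mono-≤ (λ c → ℕ.+-monoˡ-≤ (row c R) (cols-approach c)) R)))
  where
  cols-approach : ∀ c → dist c (a + 1ℤ) ℕ.+ dist c (b - 1ℤ) ℕ.≤ dist c a ℕ.+ dist c b
  cols-approach c = subst₂ ℕ._≤_ (cong₂ ℕ._+_ (dist-comm _ c) (dist-comm _ c))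
                                 (cong₂ ℕ._+_ (dist-comm a c) (dist-comm b c)) (dist-approach {a} {b} a+1<b c)

pairTerm≡dist : (z : Fin k → ℤ) (s t : Fin k) → pairTerm z s t ≡ dist (z s) (z t)
pairTerm≡dist z s t with s ≟ t
... | yes refl = sym (dist-self (z s))
... | no  _    = refl

Δ-tabulate : (z : Fin k → ℤ) → Δ z ≡ Δˡ (tabulate z)
Δ-tabulate z = begin
  Δ z                                           ≡⟨ Σℕ-tabulate (λ s → Σℕ (pairTerm z s)) ⟩
  sum (tabulate (λ s → Σℕ (pairTerm z s)))      ≡⟨ cong sum (List.tabulate-cong row≡) ⟩
  sum (tabulate (λ s → row (z s) (tabulate z))) ≡⟨ cong sum (List.map-tabulate z (λ a → row a (tabulate z))) ⟨
  Δˡ (tabulate z)                               ∎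
  where
  open ≡-Reasoning
  row≡ : ∀ s → Σℕ (pairTerm z s) ≡ row (z s) (tabulate z)
  row≡ s = begin
    Σℕ (pairTerm z s)                   ≡⟨ Σℕ-tabulate (pairTerm z s) ⟩
    sum (tabulate (pairTerm z s))       ≡⟨ cong sum (List.tabulate-cong (pairTerm≡dist z s)) ⟩
    sum (tabulate (dist (z s) ∘ z))     ≡⟨ cong sum (List.map-tabulate z (dist (z s))) ⟨
    row (z s) (tabulate z)              ∎

Δˡ-↭ : ∀ {L L′} → L ↭ L′ → Δˡ L ≡ Δˡ L′
Δˡ-↭ {L} {L′} L↭L′ = begin
  sum (map (λ a → row a L) L)   ≡⟨ cong sum (List.map-cong (λ a → sum-↭ (↭.map⁺ (dist a) L↭L′)) L) ⟩
  sum (map (λ a → row a L′) L)  ≡⟨ sum-↭ (↭.map⁺ (λ a → row a L′) L↭L′) ⟩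
  sum (map (λ a → row a L′) L′) ∎
  where open ≡-Reasoning

Δ-↓ : (z : Fin k → ℤ) → Δ z ≡ Δˡ (z ↓)
Δ-↓ z = trans (Δ-tabulate z) (Δˡ-↭ (↭-sym (↓-↭ z)))

↭-extract : ∀ {A : Set} {xs : List A} {x} → Unique xs → x ∈ˡ xs → ∃ λ ys → xs ↭ x ∷ ys × Unique (x ∷ ys)
↭-extract {A} {x = x} xs! x∈xs with ys , zs , refl ← ∈-∃++ x∈xs =
  ys ++ zs , ↭.shift x ys zs , Unique-resp-↭ (setoid A) (↭⇒↭ₛ (↭.shift x ys zs)) xs!

allFin-↭-pair : ∀ {s t : Fin k} → s ≢ t →
  ∃ λ C → allFin k ↭ s ∷ t ∷ C × All (s ≢_) C × All (t ≢_) C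
allFin-↭-pair {k} {s} {t} s≢t
  with C₁ , allFin↭ , s∉C₁ ∷ C₁! ← ↭-extract (allFin⁺ k) (∈-allFin s)
  with C , C₁↭ , t∉C ∷ _ ← ↭-extract C₁! (Any.tail (s≢t ∘ sym) (↭.∈-resp-↭ allFin↭ (∈-allFin t)))
  with _ ∷ s∉C ← ↭.All-resp-↭ C₁↭ s∉C₁
  = C , ↭-trans allFin↭ (↭-prep s C₁↭) , s∉C , t∉C

Δ-transfer : ∀ (y : Fin k → ℤ) {s t} → y s + 1ℤ ℤ.< y t → Δ (transfer y s t) ℕ.< Δ y
Δ-transfer y {s} {t} gap with C , allFin↭ , s∉C , t∉C ← allFin-↭-pair (gap⇒≢ y gap) = begin-strict
  Δ y′                                            ≡⟨ Δ-map y′ ⟩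
  Δˡ (y′ s ∷ y′ t ∷ map y′ C)                     ≡⟨ cong Δˡ values ⟩
  Δˡ ((y s + 1ℤ) ∷ (y t - 1ℤ) ∷ map y C)          <⟨ Δˡ-approach {y s} {y t} gap (map y C) ⟩
  Δˡ (y s ∷ y t ∷ map y C)                        ≡⟨ Δ-map y ⟨
  Δ y                                             ∎
  where
  open ℕ.≤-Reasoning
  y′ = transfer y s t
  s≢t = gap⇒≢ y gap
  Δ-map : ∀ f → Δ f ≡ Δˡ (map f (s ∷ t ∷ C))
  Δ-map f = trans (Δ-tabulate f)
    (trans (cong Δˡ (sym (List.map-tabulate id f))) (Δˡ-↭ (↭.map⁺ f allFin↭)))
  values : y′ s ∷ y′ t ∷ map y′ C ≡ (y s + 1ℤ) ∷ (y t - 1ℤ) ∷ map y C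
  values = cong₂ _∷_ (transfer-to y (s≢t ∘ sym)) (cong₂ _∷_ (transfer-from y s≢t)
    (List.map-cong-local (All.zipWith (λ (s≢u , t≢u) → transfer-other y s≢u t≢u) (s∉C , t∉C))))

module _ {k} (p : Subset k → Maybe ℤ) (p-super : Supermodular p) where
  open TightSets p p-super

  balanced⇒↓-lexmin : ∀ {x z} → InB p x → Balanced p x → InB p z → LexLeq (x ↓) (z ↓)
  balanced⇒↓-lexmin {x} {z} x∈B balanced z∈B =
    lex-from-excess (↓-descending x) (↓-descending z) (trans (length-↓ x) (sym (length-↓ z)))
      λ c → subst₂ ℤ._≤_ (excess-↓ x c) (excess-↓ z c) (excess-minimal x∈B balanced z∈B c)
    where
    length-↓ : ∀ x → length (x ↓) ≡ k
    length-↓ x = trans (↭.↭-length (↓-↭ x)) (List.length-tabulate x)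

  Δ-min⇒balanced : ∀ {m} → MinimizesΔ p m → Balanced p m
  Δ-min⇒balanced {m} (m∈B , m-min) s t gap with separated? p m t s
  ... | yes sep   = sep
  ... | no  ¬sep = contradiction (m-min _ (transfer-∈B m∈B ¬sep)) (ℕ.<⇒≱ (Δ-transfer m gap))

  descend-to-balanced : ∀ {y} → InB p y → Acc ℕ._<_ (Δ y) →
    ∃ λ y* → InB p y* × Balanced p y* × Δ y* ℕ.≤ Δ y
  descend-to-balanced {y} y∈B (acc rec) with balanced-or-improvable p y
  ... | inj₁ balanced = y , y∈B , balanced , ℕ.≤-refl
  ... | inj₂ (s , t , gap , ¬sep)
    with y* , y*∈B , balanced , Δy*≤ ← descend-to-balanced (transfer-∈B y∈B ¬sep) (rec (Δ-transfer y gap))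
    = y* , y*∈B , balanced , ℕ.≤-trans Δy*≤ (ℕ.<⇒≤ (Δ-transfer y gap))

theorem6p8 : (n : ℕ) (p : Subset (suc n) → Maybe ℤ) → Supermodular p →
    (m : Fin (suc n) → ℤ) → InB p m → (MinimizesΔ p m ⇔ DecMin p m)
theorem6p8 n p p-super m m∈B = mk⇔ Δ-min⇒dec-min dec-min⇒Δ-min
  where
  Δ-min⇒dec-min : MinimizesΔ p m → DecMin p m
  Δ-min⇒dec-min Δ-min = m∈B , λ y y∈B → balanced⇒↓-lexmin p p-super m∈B (Δ-min⇒balanced p p-super Δ-min) y∈B
  dec-min⇒Δ-min : DecMin p m → MinimizesΔ p m
  dec-min⇒Δ-min (_ , m-lexmin) = m∈B , λ y y∈B →
    let y* , y*∈B , balanced , Δy*≤Δy = descend-to-balanced p p-super y∈B (<-wellFounded (Δ y))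
        m↓≡y*↓ = lex-antisym (m-lexmin y* y*∈B) (balanced⇒↓-lexmin p p-super y*∈B balanced m∈B)
    in subst (ℕ._≤ Δ y) (trans (Δ-↓ y*) (trans (cong Δˡ (sym m↓≡y*↓)) (sym (Δ-↓ m)))) Δy*≤Δy
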